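{- All threshold graphs are $\frac12$-hyperbolic.
   Context: Graphs are simple, unweighted, connected, possibly infinite, with shortest-path metric $d_G$, $xy:=d_G(x,y)$. For vertices $x,y,u,v$, $\delta(x,y,u,v)$ is the difference between the largest and second largest of $\frac{uv+xy}{2},\frac{ux+vy}{2},\frac{uy+vx}{2}$; $G$ is $\delta$-hyperbolic if $\delta(x,y,u,v)\le\delta$ for all vertices. A threshold graph is a graph with no induced subgraph isomorphic to the $4$-cycle, to the complement of the $4$-cycle, or to the path of length $3$. -}

module Defs where

open import Level using (0ℓ)
open import Data.Nat using (ℕ; zero; suc; _+_; _∸_; _⊔_; _⊓_; _≤_)
open import Data.Product using (Σ; ∃; _×_; _,_)
open import Relation.Nullary using (¬_)
open import Relation.Binary.PropositionalEquality using (_≡_)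

record Graph : Set₁ where
  field
    V     : Set
    E     : V → V → Set
    sym   : ∀ {x y} → E x y → E y x
    irrefl : ∀ {x} → ¬ E x x

module _ (G : Graph) where
  open Graph G

  data Walk : V → V → ℕ → Set where
    here : ∀ {x} → Walk x x zero
    step : ∀ {x y z n} → E x y → Walk y z n → Walk x z (suc n)

  Connected : Set
  Connected = ∀ x y → ∃ λ n → Walk x y n

  IsDist : V → V → ℕ → Set
  IsDist x y n = Walk x y n × (∀ m → Walk x y m → n ≤ m)

  Distinct4 : V → V → V → V → Set
  Distinct4 a b c d = ¬ a ≡ b × ¬ a ≡ c × ¬ a ≡ d × ¬ b ≡ c × ¬ b ≡ d × ¬ c ≡ d

  InducedC4 : Set
  InducedC4 = Σ V λ a → Σ V λ b → Σ V λ c → Σ V λ d →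
    Distinct4 a b c d × E a b × E b c × E c d × E d a × ¬ E a c × ¬ E b d

  InducedCoC4 : Set
  InducedCoC4 = Σ V λ a → Σ V λ b → Σ V λ c → Σ V λ d →
    Distinct4 a b c d × E a b × E c d ×
    ¬ E a c × ¬ E a d × ¬ E b c × ¬ E b d

  InducedP4 : Set
  InducedP4 = Σ V λ a → Σ V λ b → Σ V λ c → Σ V λ d →
    Distinct4 a b c d × E a b × E b c × E c d ×
    ¬ E a c × ¬ E b d × ¬ E a d

  Threshold : Set
  Threshold = ¬ InducedC4 × ¬ InducedCoC4 × ¬ InducedP4

-- Twice δ: given the three pair sums s₁ = uv+xy, s₂ = ux+vy, s₃ = uy+vx,
-- 2·δ = (largest of the sᵢ) − (second largest of the sᵢ).
-- (Second largest of three numbers = their median.)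
largest3 : ℕ → ℕ → ℕ → ℕ
largest3 a b c = a ⊔ b ⊔ c

second3 : ℕ → ℕ → ℕ → ℕ
second3 a b c = (a ⊓ b) ⊔ (b ⊓ c) ⊔ (a ⊓ c)

twiceδ : ℕ → ℕ → ℕ → ℕ
twiceδ a b c = largest3 a b c ∸ second3 a b c

-- G is (k/2)-hyperbolic: for all vertices x y u v, δ(x,y,u,v) ≤ k/2,
-- i.e. 2·δ(x,y,u,v) ≤ k.  Distances are given via the IsDist relation
-- (they exist and are unique in a connected graph).
HalfHyperbolic : (G : Graph) → ℕ → Set
HalfHyperbolic G k = ∀ x y u v (xy ux uy vx vy uv : ℕ) →
  IsDist G x y xy → IsDist G u x ux → IsDist G u y uy →
  IsDist G v x vx → IsDist G v y vy → IsDist G u v uv →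
  twiceδ (uv + xy) (ux + vy) (uy + vx) ≤ k

-- Only two of the three forbidden subgraphs are needed.  A shortest path
-- of length 3 would be an induced P₄, so all distances are at most 2.
-- If the largest of the three pair sums S₁, S₂, S₃ of four points exceeded
-- both others by 2, the triangle inequality (ab + cd ≤ ac + bd + 2·bc etc.)
-- forces the four "side" distances to be positive; with distances at most 2
-- this pins the opposite pair at distance 2 and the sides at distance 1,
-- i.e. an induced C₄.  Otherwise the largest pair sum is within 1 of the
-- median, which is exactly 2δ ≤ 1.
module Submission where

open import Defs
open import Data.Nat using (ℕ; zero; suc; _+_; _≤_; _<_; _⊓_; z≤n; s≤s; _≤?_)
open import Data.Nat.Properties
  using ( ≤-refl; ≤-trans; ≤-total; <⇒≱; ≰⇒>; n≤1+n; n<1+n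
        ; +-comm; +-identityʳ; +-mono-≤; +-monoʳ-≤; +-monoˡ-<; +-cancelˡ-≤; +-cancelʳ-≤
        ; m≤m⊔n; m≤n⊔m; ⊔-lub; ⊓-comm; m≤n⇒m⊓n≡m; m≥n⇒m⊓n≡n; m≤n+o⇒m∸n≤o )
open import Data.Empty using (⊥; ⊥-elim)
open import Data.Product using (_×_; _,_)
open import Data.Sum using (_⊎_; inj₁; inj₂)
open import Relation.Nullary using (¬_; yes; no)
open import Relation.Binary.PropositionalEquality using (_≡_; _≢_; refl; sym; subst)

private variable
  p q s t e x y z : ℕ

Near : ℕ → ℕ → ℕ → Set
Near x y z = x ≤ suc y ⊎ x ≤ suc z

near-unless-dominant : ∀ x y z → (suc y < x → suc z < x → ⊥) → Near x y z
near-unless-dominant x y z not-dominant with x ≤? suc y | x ≤? suc z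
... | yes x≤1+y | _         = inj₁ x≤1+y
... | no _      | yes x≤1+z = inj₂ x≤1+z
... | no x≰1+y  | no x≰1+z  = ⊥-elim (not-dominant (≰⇒> x≰1+y) (≰⇒> x≰1+z))

≤suc⇒≤suc-⊓ : x ≤ suc y → x ≤ suc (x ⊓ y)
≤suc⇒≤suc-⊓ {x} {y} x≤1+y with ≤-total x y
... | inj₁ x≤y rewrite m≤n⇒m⊓n≡m x≤y = n≤1+n x
... | inj₂ y≤x rewrite m≥n⇒m⊓n≡n y≤x = x≤1+y

-- Each element is within 1 of its minimum with some other element, and all
-- three pairwise minima lie below the median.
twiceδ≤1 : Near x y z → Near y x z → Near z x y → twiceδ x y z ≤ 1
twiceδ≤1 {x} {y} {z} near-x near-y near-z =
  m≤n+o⇒m∸n≤o (largest3 x y z) median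
    (subst (largest3 x y z ≤_) (+-comm 1 median)
      (⊔-lub (⊔-lub (bound xy≤ xz≤ near-x) (bound yx≤ yz≤ near-y)) (bound zx≤ zy≤ near-z)))
  where
  median : ℕ
  median = second3 x y z

  xy≤ : x ⊓ y ≤ median
  xy≤ = ≤-trans (m≤m⊔n _ _) (m≤m⊔n _ _)
  yz≤ : y ⊓ z ≤ median
  yz≤ = ≤-trans (m≤n⊔m (x ⊓ y) _) (m≤m⊔n _ _)
  xz≤ : x ⊓ z ≤ median
  xz≤ = m≤n⊔m _ _
  yx≤ : y ⊓ x ≤ median
  yx≤ = subst (_≤ median) (⊓-comm x y) xy≤
  zx≤ : z ⊓ x ≤ median
  zx≤ = subst (_≤ median) (⊓-comm x z) xz≤
  zy≤ : z ⊓ y ≤ median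
  zy≤ = subst (_≤ median) (⊓-comm y z) yz≤

  bound : ∀ {a b c} → a ⊓ b ≤ median → a ⊓ c ≤ median → Near a b c → a ≤ suc median
  bound ab≤ _ (inj₁ a≤1+b) = ≤-trans (≤suc⇒≤suc-⊓ a≤1+b) (s≤s ab≤)
  bound _ ac≤ (inj₂ a≤1+c) = ≤-trans (≤suc⇒≤suc-⊓ a≤1+c) (s≤s ac≤)

dominated⇒detour-positive : x ≤ s + e → y ≤ t + e → suc (s + t) < x + y → 1 ≤ e
dominated⇒detour-positive {e = suc _} _ _ _ = s≤s z≤n
dominated⇒detour-positive {s = s} {e = zero} {t = t} x≤s y≤t dominated =
  ⊥-elim (<⇒≱ dominated (≤-trans (+-mono-≤ (drop-zero x≤s) (drop-zero y≤t)) (n≤1+n (s + t))))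
  where
  drop-zero : ∀ {m n} → m ≤ n + 0 → m ≤ n
  drop-zero {m} {n} = subst (m ≤_) (+-identityʳ n)

dominated-within-2⇒squeezed : p ≤ 2 → q ≤ 2 → 1 ≤ s → 1 ≤ t → suc (s + t) < p + q →
  2 ≤ p × 2 ≤ q × s ≤ 1 × t ≤ 1
dominated-within-2⇒squeezed {p} {q} {s} {t} p≤2 q≤2 1≤s 1≤t dominated =
  +-cancelʳ-≤ 2 2 p (≤-trans 4≤p+q (+-monoʳ-≤ p q≤2)) ,
  +-cancelˡ-≤ 2 2 q (≤-trans 4≤p+q (+-mono-≤ p≤2 ≤-refl)) ,
  +-cancelʳ-≤ 1 s 1 (≤-trans (+-monoʳ-≤ s 1≤t) s+t≤2) ,
  +-cancelˡ-≤ 1 t 1 (≤-trans (+-mono-≤ 1≤s ≤-refl) s+t≤2)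
  where
  4≤p+q : 4 ≤ p + q
  4≤p+q = ≤-trans (s≤s (s≤s (+-mono-≤ 1≤s 1≤t))) dominated
  s+t≤2 : s + t ≤ 2
  s+t≤2 = +-cancelˡ-≤ 2 (s + t) 2 (≤-trans dominated (+-mono-≤ p≤2 q≤2))

module _ (G : Graph) where
  open Graph G renaming (sym to E-sym)

  private variable
    a b c d : V
    j m n o : ℕ

  _++ᵂ_ : Walk G a b m → Walk G b c n → Walk G a c (m + n)
  here      ++ᵂ q = q
  step ab p ++ᵂ q = step ab (p ++ᵂ q)

  reverseᵂ : Walk G a b n → Walk G b a n
  reverseᵂ here                = here
  reverseᵂ (step {n = n} ab p) = subst (Walk G _ _) (+-comm n 1) (reverseᵂ p ++ᵂ step (E-sym ab) here)

  IsDist-sym : IsDist G a b n → IsDist G b a n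
  IsDist-sym (p , shortest) = reverseᵂ p , λ m q → shortest m (reverseᵂ q)

  IsDist-triangle : IsDist G a b m → IsDist G b c n → IsDist G a c o → o ≤ m + n
  IsDist-triangle (p , _) (q , _) (_ , shortest) = shortest _ (p ++ᵂ q)

  E⇒≢ : E a b → a ≢ b
  E⇒≢ ab refl = irrefl ab

  IsDist-1⇒E : IsDist G a b n → 1 ≤ n → n ≤ 1 → E a b
  IsDist-1⇒E (step ab here , _) (s≤s z≤n) (s≤s z≤n) = ab

  IsDist-≥2⇒¬E : IsDist G a b n → 2 ≤ n → ¬ E a b
  IsDist-≥2⇒¬E (_ , shortest) (s≤s (s≤s _)) ab with shortest 1 (step ab here)
  ... | s≤s ()

  IsDist-≥2⇒≢ : IsDist G a b n → 2 ≤ n → a ≢ b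
  IsDist-≥2⇒≢ (_ , shortest) (s≤s (s≤s _)) refl with shortest 0 here
  ... | ()

  DiameterAtMost : ℕ → Set
  DiameterAtMost k = ∀ {a b n} → IsDist G a b n → n ≤ k

  -- The first four vertices of a shortest walk of length ≥ 3 span an induced P₄:
  -- any coincidence or chord among them would shorten the walk.
  P4-free⇒diameter≤2 : ¬ InducedP4 G → DiameterAtMost 2
  P4-free⇒diameter≤2 _ {n = 0} _ = z≤n
  P4-free⇒diameter≤2 _ {n = 1} _ = s≤s z≤n
  P4-free⇒diameter≤2 _ {n = 2} _ = s≤s (s≤s z≤n)
  P4-free⇒diameter≤2 noP4 {x₀} {y} {suc (suc (suc k))}
    (step {y = x₁} e₀₁ (step {y = x₂} e₁₂ (step {y = x₃} e₂₃ rest)) , shortest) =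
    ⊥-elim (noP4 (x₀ , x₁ , x₂ , x₃ ,
                  (E⇒≢ e₀₁ , x₀≢x₂ , x₀≢x₃ , E⇒≢ e₁₂ , x₁≢x₃ , E⇒≢ e₂₃) ,
                  e₀₁ , e₁₂ , e₂₃ , ¬e₀₂ , ¬e₁₃ , ¬e₀₃))
    where
    shorter : ∀ j → j < 3 → Walk G x₀ y (j + k) → ⊥
    shorter j j<3 p = <⇒≱ (+-monoˡ-< k j<3) (shortest _ p)

    from : ∀ {w} → w ≡ x₀ → Walk G w y j → Walk G x₀ y j
    from {j = j} eq = subst (λ w → Walk G w y j) eq

    x₀≢x₂ : x₀ ≢ x₂
    x₀≢x₂ eq = shorter 1 (s≤s (s≤s z≤n)) (from (sym eq) (step e₂₃ rest))
    x₀≢x₃ : x₀ ≢ x₃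
    x₀≢x₃ eq = shorter 0 (s≤s z≤n) (from (sym eq) rest)
    x₁≢x₃ : x₁ ≢ x₃
    x₁≢x₃ eq = shorter 1 (s≤s (s≤s z≤n)) (step e₀₁ (subst (λ w → Walk G w y k) (sym eq) rest))
    ¬e₀₂ : ¬ E x₀ x₂
    ¬e₀₂ e = shorter 2 (n<1+n 2) (step e (step e₂₃ rest))
    ¬e₁₃ : ¬ E x₁ x₃
    ¬e₁₃ e = shorter 2 (n<1+n 2) (step e₀₁ (step e rest))
    ¬e₀₃ : ¬ E x₀ x₃
    ¬e₀₃ e = shorter 1 (s≤s (s≤s z≤n)) (step e rest)

  dominant-pairSum⇒InducedC4 : ∀ {ab cd ac bd ad bc} → DiameterAtMost 2 →
    IsDist G a b ab → IsDist G c d cd → IsDist G a c ac →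
    IsDist G b d bd → IsDist G a d ad → IsDist G b c bc →
    suc (ac + bd) < ab + cd → suc (ad + bc) < ab + cd → InducedC4 G
  dominant-pairSum⇒InducedC4 {a = a} {b} {c} {d} {ab} {cd} {ac} {bd} {ad} {bc}
    diam dab dcd dac dbd dad dbc ac+bd<ab+cd ad+bc<ab+cd =
    cycle (dominated-within-2⇒squeezed (diam dab) (diam dcd) 1≤ac 1≤bd ac+bd<ab+cd)
          (dominated-within-2⇒squeezed (diam dab) (diam dcd) 1≤ad 1≤bc ad+bc<ab+cd)
    where
    flip : ∀ {n} → n < ab + cd → n < cd + ab
    flip {n} = subst (n <_) (+-comm ab cd)

    1≤bc : 1 ≤ bc
    1≤bc = dominated⇒detour-positive
      (IsDist-triangle dac (IsDist-sym dbc) dab)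
      (IsDist-triangle (IsDist-sym dbd) dbc (IsDist-sym dcd)) ac+bd<ab+cd
    1≤ad : 1 ≤ ad
    1≤ad = dominated⇒detour-positive
      (IsDist-triangle (IsDist-sym dac) dad dcd)
      (IsDist-triangle dbd (IsDist-sym dad) (IsDist-sym dab)) (flip ac+bd<ab+cd)
    1≤ac : 1 ≤ ac
    1≤ac = dominated⇒detour-positive
      (IsDist-triangle (IsDist-sym dad) dac (IsDist-sym dcd))
      (IsDist-triangle dbc (IsDist-sym dac) (IsDist-sym dab)) (flip ad+bc<ab+cd)
    1≤bd : 1 ≤ bd
    1≤bd = dominated⇒detour-positive
      (IsDist-triangle dad (IsDist-sym dbd) dab)
      (IsDist-triangle (IsDist-sym dbc) dbd dcd) ad+bc<ab+cd

    cycle : 2 ≤ ab × 2 ≤ cd × ac ≤ 1 × bd ≤ 1 → 2 ≤ ab × 2 ≤ cd × ad ≤ 1 × bc ≤ 1 → InducedC4 G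
    cycle (2≤ab , 2≤cd , ac≤1 , bd≤1) (_ , _ , ad≤1 , bc≤1) =
      a , c , b , d ,
      (E⇒≢ e-ac , IsDist-≥2⇒≢ dab 2≤ab , E⇒≢ (E-sym e-da) , E⇒≢ e-cb , IsDist-≥2⇒≢ dcd 2≤cd , E⇒≢ e-bd) ,
      e-ac , e-cb , e-bd , e-da , IsDist-≥2⇒¬E dab 2≤ab , IsDist-≥2⇒¬E dcd 2≤cd
      where
      e-ac : E a c
      e-ac = IsDist-1⇒E dac 1≤ac ac≤1
      e-cb : E c b
      e-cb = IsDist-1⇒E (IsDist-sym dbc) 1≤bc bc≤1
      e-bd : E b d
      e-bd = IsDist-1⇒E dbd 1≤bd bd≤1
      e-da : E d a
      e-da = IsDist-1⇒E (IsDist-sym dad) 1≤ad ad≤1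

  C4-free∧diameter≤2⇒halfHyperbolic : ¬ InducedC4 G → DiameterAtMost 2 → HalfHyperbolic G 1
  C4-free∧diameter≤2⇒halfHyperbolic noC4 diam x y u v xy ux uy vx vy uv dxy dux duy dvx dvy duv =
    twiceδ≤1
      (near-unless-dominant _ _ _ λ S₂<S₁ S₃<S₁ → noC4
        (dominant-pairSum⇒InducedC4 diam duv dxy dux dvy duy dvx S₂<S₁ S₃<S₁))
      (near-unless-dominant _ _ _ λ S₁<S₂ S₃<S₂ → noC4
        (dominant-pairSum⇒InducedC4 diam dux dvy duv dxy duy (IsDist-sym dvx) S₁<S₂ S₃<S₂))
      (near-unless-dominant _ _ _ λ S₁<S₃ S₂<S₃ → noC4
        (dominant-pairSum⇒InducedC4 diam duy dvx duv (IsDist-sym dxy) dux (IsDist-sym dvy) S₁<S₃ S₂<S₃))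

corollary2p18 : (G : Graph) → Connected G → Threshold G → HalfHyperbolic G 1
corollary2p18 G _ (noC4 , _ , noP4) =
  C4-free∧diameter≤2⇒halfHyperbolic G noC4 (P4-free⇒diameter≤2 G noP4)
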